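{- Let $q\ge 2$, $n\ge 1$, $d\ge 1$ be integers and let $F:Q^V\to Q^V$ be an automata network with $Q=\{0,\dots,q-1\}$, $V=\{1,\dots,n\}$, of degree at most $d$. Let $U\subseteq V$ with $|U|\le\lfloor n/d\rfloor$. Then for every pattern $u\in Q^U$, the number $|F^{ -1}([u])|$ is a multiple of $q^{\,n-|U|d}$, where $[u]=\{x\in Q^V: x_U=u\}$.
   Context: An automata network is a map $F:Q^V\to Q^V$ with local functions $f_j(x)=F(x)_j$. Its interaction graph has an arc $(i,j)$ iff $f_j$ effectively depends on $x_i$ (there exist $x,x'$ differing only at $i$ with $f_j(x)\neq f_j(x')$). The degree of $F$ is the maximum in-degree of its interaction graph. For $x\in Q^V$ and $U\subseteq V$, $x_U$ denotes the restriction of $x$ to $U$. -}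

module Defs where

open import Data.Nat using (ℕ; zero; suc; _≤_)
open import Data.Fin using (Fin; zero; suc; _≟_)
open import Data.Fin.Subset using (Subset; _∈_; ∣_∣)
open import Data.Fin.Subset.Properties using (_∈?_)
open import Data.List using (List; []; _∷_; map; concatMap; length; allFin; filterᵇ)
open import Data.Bool.ListAction using (all)
open import Data.Bool using (Bool; true; false; if_then_else_)
open import Data.Product using (Σ; _×_; _,_)
open import Relation.Binary.PropositionalEquality using (_≡_; _≢_)
open import Relation.Nullary using (does)

-- Configurations x ∈ Q^V with Q = Fin q = {0,…,q-1}, V = Fin n ({1,…,n} reindexed from 0).
Config : ℕ → ℕ → Set
Config n q = Fin n → Fin q

AN : ℕ → ℕ → Set
AN n q = Config n q → Config n q

Arc : ∀ {n q} → AN n q → Fin n → Fin n → Set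
Arc {n} {q} F i j =
  Σ (Config n q) λ x → Σ (Config n q) λ x' →
    (∀ k → k ≢ i → x k ≡ x' k) × (F x j ≢ F x' j)

DegreeAtMost : ∀ {n q} → AN n q → ℕ → Set
DegreeAtMost {n} F d =
  ∀ j → Σ (Subset n) λ S → (∣ S ∣ ≤ d) × (∀ i → Arc F i j → i ∈ S)

allConfigs : (n q : ℕ) → List (Config n q)
allConfigs zero    q = (λ ()) ∷ []
allConfigs (suc n) q =
  concatMap (λ a → map (λ x → cons a x) (allConfigs n q)) (allFin q)
  where
  cons : Fin q → Config n q → Config (suc n) q
  cons a x zero    = a
  cons a x (suc i) = x i

-- Boolean test of  y_U = u_U  (u is given as a full configuration; only u_U matters).
agreeOnᵇ : ∀ {n q} → Subset n → Config n q → Config n q → Bool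
agreeOnᵇ {n} U y u =
  all (λ i → if does (i ∈? U) then does (y i ≟ u i) else true) (allFin n)

preimageCount : ∀ {n q} → AN n q → Subset n → Config n q → ℕ
preimageCount {n} {q} F U u =
  length (filterᵇ (λ x → agreeOnᵇ U (F x) u) (allConfigs n q))

-- The condition F(x)_U = u only looks at the coordinates of x in the union W of the
-- in-neighbourhoods of the vertices of U, and |W| ≤ |U| d. A Boolean predicate on Q^n that
-- ignores every coordinate outside W is constant along each of the q^(n - |W|) choices of
-- the coordinates outside W, so the number of configurations satisfying it is a multiple
-- of q^(n - |W|), hence of q^(n - |U| d).
module Submission where

open import Defs
open import Data.Nat using (ℕ; _≤_; _/_; _*_; _∸_; _^_; NonZero)
open import Data.Nat.Divisibility using (_∣_)
open import Data.Fin.Subset using (Subset; ∣_∣)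
open import Data.Nat using (zero; suc; _+_; z≤n; s≤s)

open import Data.Bool using (Bool; true; false; if_then_else_)
open import Data.Bool.ListAction using (and)
open import Data.Fin using (Fin; zero; suc; _≟_)
open import Data.Fin.Subset using (_∈_; _∉_; _∪_; ⊥; inside; outside)
open import Data.Fin.Subset.Properties using (_∈?_; ∣p∣≤n; ∣⊥∣≡0; x∈p∪q⁺)
open import Data.List using (List; []; _∷_; _++_; map; concatMap; length; allFin; filterᵇ)
open import Data.List.Properties using (length-++; filter-++; length-tabulate; map-cong)
open import Data.Nat.Divisibility using (1∣_; _∣0; ∣-trans; m∣m*n; ∣m∣n⇒∣m+n; *-monoʳ-∣)
open import Data.Nat.Properties
  using (≤-trans; ≤-reflexive; n≤1+n; +-suc; +-mono-≤; +-monoʳ-≤; +-∸-assoc; ∸-monoʳ-≤;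
         m+[n∸m]≡n; ^-distribˡ-+-*)
open import Data.Product using (_,_; proj₁; proj₂)
open import Data.Sum using (inj₁; inj₂)
open import Data.Vec using ([]; _∷_; here; there)
open import Function using (_∘_)
open import Relation.Binary.PropositionalEquality
open import Relation.Nullary using (¬_; yes; no; does)
open import Relation.Nullary.Decidable using (decidable-stable)
open import Data.Empty using (⊥-elim)

^-monoʳ-∣ : ∀ q {a b} → a ≤ b → q ^ a ∣ q ^ b
^-monoʳ-∣ q {a} {b} a≤b =
  subst (λ e → q ^ a ∣ q ^ e) (m+[n∸m]≡n a≤b)
    (subst (q ^ a ∣_) (sym (^-distribˡ-+-* q a (b ∸ a))) (m∣m*n (q ^ (b ∸ a))))

count : ∀ {A : Set} → (A → Bool) → List A → ℕ
count p xs = length (filterᵇ p xs)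

count-++ : ∀ {A : Set} (p : A → Bool) xs ys → count p (xs ++ ys) ≡ count p xs + count p ys
count-++ p xs ys = trans (cong length (filter-++ _ xs ys)) (length-++ (filterᵇ p xs))

count-map : ∀ {A B : Set} (p : B → Bool) (g : A → B) xs → count p (map g xs) ≡ count (p ∘ g) xs
count-map p g []       = refl
count-map p g (x ∷ xs) with p (g x)
... | true  = cong suc (count-map p g xs)
... | false = count-map p g xs

count-cong : ∀ {A : Set} {p p' : A → Bool} → (∀ x → p x ≡ p' x) → ∀ xs → count p xs ≡ count p' xs
count-cong           p≗p' []       = refl
count-cong {p' = p'} p≗p' (x ∷ xs) rewrite p≗p' x with p' x
... | true  = cong suc (count-cong p≗p' xs)
... | false = count-cong p≗p' xs

∣-count-concatMap : ∀ {A B : Set} {m} (p : B → Bool) (f : A → List B) as →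
  (∀ a → m ∣ count p (f a)) → m ∣ count p (concatMap f as)
∣-count-concatMap p f []       m∣ = _ ∣0
∣-count-concatMap p f (a ∷ as) m∣ =
  subst (_ ∣_) (sym (count-++ p (f a) (concatMap f as)))
    (∣m∣n⇒∣m+n (m∣ a) (∣-count-concatMap p f as m∣))

count-concatMap-const : ∀ {A B : Set} {c} (p : B → Bool) (f : A → List B) as →
  (∀ a → count p (f a) ≡ c) → count p (concatMap f as) ≡ length as * c
count-concatMap-const p f []       ≡c = refl
count-concatMap-const p f (a ∷ as) ≡c = begin
  count p (f a ++ concatMap f as)         ≡⟨ count-++ p (f a) (concatMap f as) ⟩
  count p (f a) + count p (concatMap f as) ≡⟨ cong₂ _+_ (≡c a) (count-concatMap-const p f as ≡c) ⟩
  _ + length as * _                        ∎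
  where open ≡-Reasoning

EqualExcept : ∀ {n q} → Fin n → Config n q → Config n q → Set
EqualExcept i x x' = ∀ k → k ≢ i → x k ≡ x' k

Ignores : ∀ {n q} {B : Set} → (Config n q → B) → Fin n → Set
Ignores f i = ∀ {x x'} → EqualExcept i x x' → f x ≡ f x'

DependsOnlyOn : ∀ {n q} {B : Set} → (Config n q → B) → Subset n → Set
DependsOnlyOn f W = ∀ i → i ∉ W → Ignores f i

-- The extension map used by allConfigs is local to Defs, so it is abstracted here
-- through its two defining equations (which hold by refl for the actual one).
module Extension {n q : ℕ} (ext : Fin (suc q) → Config n (suc q) → Config (suc n) (suc q))
  (ext-zero : ∀ a x → ext a x zero ≡ a) (ext-suc : ∀ a x i → ext a x (suc i) ≡ x i) where

  extendedBy : Fin (suc q) → List (Config (suc n) (suc q))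
  extendedBy a = map (ext a) (allConfigs n (suc q))

  extensions : List (Config (suc n) (suc q))
  extensions = concatMap extendedBy (allFin (suc q))

  equalExcept-suc : ∀ {i x x'} a → EqualExcept i x x' → EqualExcept (suc i) (ext a x) (ext a x')
  equalExcept-suc {x = x} {x'} a x≈x' zero    _    = trans (ext-zero a x) (sym (ext-zero a x'))
  equalExcept-suc {x = x} {x'} a x≈x' (suc k) k≢i =
    trans (ext-suc a x k) (trans (x≈x' k (k≢i ∘ cong suc)) (sym (ext-suc a x' k)))

  equalExcept-zero : ∀ a b x → EqualExcept zero (ext a x) (ext b x)
  equalExcept-zero a b x zero    0≢0 = ⊥-elim (0≢0 refl)
  equalExcept-zero a b x (suc k) _   = trans (ext-suc a x k) (sym (ext-suc b x k))

  dependsOnlyOn-ext : ∀ {p : Config (suc n) (suc q) → Bool} {b W} a →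
    DependsOnlyOn p (b ∷ W) → DependsOnlyOn (p ∘ ext a) W
  dependsOnlyOn-ext a dep i i∉W x≈x' =
    dep (suc i) (λ { (there i∈W) → i∉W i∈W }) (equalExcept-suc a x≈x')

  count-extensions : ∀ p → Ignores p zero →
    count p extensions ≡ suc q * count (p ∘ ext zero) (allConfigs n (suc q))
  count-extensions p ignores₀ =
    trans (count-concatMap-const p extendedBy (allFin (suc q)) count-ext)
          (cong (_* count (p ∘ ext zero) (allConfigs n (suc q))) (length-tabulate {n = suc q} (λ a → a)))
    where
    count-ext : ∀ a → count p (extendedBy a) ≡ count (p ∘ ext zero) (allConfigs n (suc q))
    count-ext a = trans (count-map p (ext a) (allConfigs n (suc q)))
      (count-cong (λ x → ignores₀ (equalExcept-zero a zero x)) (allConfigs n (suc q)))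

  ∣-count-extensions :
    (∀ p W → DependsOnlyOn p W → suc q ^ (n ∸ ∣ W ∣) ∣ count p (allConfigs n (suc q))) →
    ∀ p W → DependsOnlyOn p W → suc q ^ (suc n ∸ ∣ W ∣) ∣ count p extensions
  ∣-count-extensions ∣count p (inside ∷ W) dep =
    ∣-count-concatMap p extendedBy (allFin (suc q)) λ a →
      subst (_ ∣_) (sym (count-map p (ext a) (allConfigs n (suc q)))) (∣count _ W (dependsOnlyOn-ext a dep))
  ∣-count-extensions ∣count p (outside ∷ W) dep =
    subst₂ _∣_ (cong (suc q ^_) (sym (+-∸-assoc 1 (∣p∣≤n W))))
               (sym (count-extensions p (dep zero λ ())))
      (*-monoʳ-∣ (suc q) (∣count _ W (dependsOnlyOn-ext zero dep)))

∣-count-dependsOnlyOn : ∀ {q} n (p : Config n (suc q) → Bool) W → DependsOnlyOn p W →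
  suc q ^ (n ∸ ∣ W ∣) ∣ count p (allConfigs n (suc q))
∣-count-dependsOnlyOn zero    p [] _ = 1∣ _
∣-count-dependsOnlyOn (suc n) =
  Extension.∣-count-extensions _ (λ _ _ → refl) (λ _ _ _ → refl) (∣-count-dependsOnlyOn n)

∣p∪q∣≤∣p∣+∣q∣ : ∀ {n} (p r : Subset n) → ∣ p ∪ r ∣ ≤ ∣ p ∣ + ∣ r ∣
∣p∪q∣≤∣p∣+∣q∣ []            []            = z≤n
∣p∪q∣≤∣p∣+∣q∣ (inside  ∷ p) (inside  ∷ r) = s≤s (≤-trans (∣p∪q∣≤∣p∣+∣q∣ p r) (+-monoʳ-≤ ∣ p ∣ (n≤1+n _)))
∣p∪q∣≤∣p∣+∣q∣ (inside  ∷ p) (outside ∷ r) = s≤s (∣p∪q∣≤∣p∣+∣q∣ p r)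
∣p∪q∣≤∣p∣+∣q∣ (outside ∷ p) (inside  ∷ r) = ≤-trans (s≤s (∣p∪q∣≤∣p∣+∣q∣ p r)) (≤-reflexive (sym (+-suc ∣ p ∣ ∣ r ∣)))
∣p∪q∣≤∣p∣+∣q∣ (outside ∷ p) (outside ∷ r) = ∣p∪q∣≤∣p∣+∣q∣ p r

unionOver : ∀ {k n} → Subset k → (Fin k → Subset n) → Subset n
unionOver []            S = ⊥
unionOver (inside  ∷ U) S = S zero ∪ unionOver U (S ∘ suc)
unionOver (outside ∷ U) S = unionOver U (S ∘ suc)

∣unionOver∣≤ : ∀ {k n d} (U : Subset k) (S : Fin k → Subset n) → (∀ j → ∣ S j ∣ ≤ d) →
  ∣ unionOver U S ∣ ≤ ∣ U ∣ * d
∣unionOver∣≤ {n = n} []  S ∣S∣≤d = ≤-reflexive (∣⊥∣≡0 n)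
∣unionOver∣≤ (inside ∷ U) S ∣S∣≤d =
  ≤-trans (∣p∪q∣≤∣p∣+∣q∣ (S zero) _) (+-mono-≤ (∣S∣≤d zero) (∣unionOver∣≤ U (S ∘ suc) (∣S∣≤d ∘ suc)))
∣unionOver∣≤ (outside ∷ U) S ∣S∣≤d = ∣unionOver∣≤ U (S ∘ suc) (∣S∣≤d ∘ suc)

∈-unionOver : ∀ {k n} (U : Subset k) (S : Fin k → Subset n) {i j} → j ∈ U → i ∈ S j → i ∈ unionOver U S
∈-unionOver (inside  ∷ U) S here       i∈S = x∈p∪q⁺ (inj₁ i∈S)
∈-unionOver (inside  ∷ U) S (there j∈U) i∈S = x∈p∪q⁺ (inj₂ (∈-unionOver U (S ∘ suc) j∈U i∈S))
∈-unionOver (outside ∷ U) S (there j∈U) i∈S = ∈-unionOver U (S ∘ suc) j∈U i∈S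

ignores-¬Arc : ∀ {n q} (F : AN n q) {i j} → ¬ Arc F i j → Ignores (λ x → F x j) i
ignores-¬Arc F {j = j} ¬arc {x} {x'} x≈x' =
  decidable-stable (F x j ≟ F x' j) (λ Fx≢Fx' → ¬arc (x , x' , x≈x' , Fx≢Fx'))

agreeOnᵇ-cong : ∀ {n q} U {y y' : Config n q} u → (∀ j → j ∈ U → y j ≡ y' j) →
  agreeOnᵇ U y u ≡ agreeOnᵇ U y' u
agreeOnᵇ-cong {n} U {y} {y'} u y≈y' = cong and (map-cong test-≡ (allFin n))
  where
  test-≡ : ∀ i → (if does (i ∈? U) then does (y i ≟ u i) else true)
               ≡ (if does (i ∈? U) then does (y' i ≟ u i) else true)
  test-≡ i with i ∈? U
  ... | yes i∈U rewrite y≈y' i i∈U = refl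
  ... | no  _   = refl

lemma1 : (q n d : ℕ) → 2 ≤ q → 1 ≤ n → 1 ≤ d → .{{_ : NonZero d}} →
    (F : AN n q) → DegreeAtMost F d →
    (U : Subset n) → ∣ U ∣ ≤ n / d →
    (u : Config n q) →
    q ^ (n ∸ ∣ U ∣ * d) ∣ preimageCount F U u
lemma1 (suc q) n d _ _ _ F deg U _ u =
  ∣-trans (^-monoʳ-∣ (suc q) (∸-monoʳ-≤ n (∣unionOver∣≤ U S (proj₁ ∘ proj₂ ∘ deg))))
          (∣-count-dependsOnlyOn n (λ x → agreeOnᵇ U (F x) u) W dependsOnlyOn-W)
  where
  S : Fin n → Subset n
  S j = proj₁ (deg j)
  W : Subset n
  W = unionOver U S
  dependsOnlyOn-W : DependsOnlyOn (λ x → agreeOnᵇ U (F x) u) W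
  dependsOnlyOn-W i i∉W x≈x' = agreeOnᵇ-cong U u λ j j∈U →
    ignores-¬Arc F (λ arc → i∉W (∈-unionOver U S j∈U (proj₂ (proj₂ (deg j)) i arc))) x≈x'
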